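{- Let $\mathbb{B}\in\mathcal{V}(\mathbb{A}'(\mathcal{T}))$, let $c,d\in B$, and let $r,t,s\in B$ with $s\le t\le r$ and $(r,t),(t,s)\in\mathrm{Cg}^{\mathbb{B}}(c,d)$. Suppose there are $p_1,p_2,q_1,q_2\in B$, some $i\in\{0,1,2\}$ and $\overline{n}$ (an element of $B$ if $i\in\{0,1\}$, a pair of elements of $B$ if $i=2$) such that $r=J(p_1,q_1,r)$, $t=J(p_1,q_1,t)=J'(p_2,q_2,t')$, and $s=J'(p_2,q_2,s')$, where $t'=e_i(\overline{n},t)$ and $s'=e_i(\overline{n},s)$. Then there exist $\rho,u\in B$ such that $r=J'(r,\rho,r')$, $u=J'(r,\rho,s')=J(u,\rho,r'')$, and $s=J(u,\rho,s'')$, where $r'=e_i(\overline{n},r)$, $r''=e_2(r,\rho,r)$ and $s''=e_2(r,\rho,s)$.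
   Context: $\mathcal{T}$ is a Turing machine with states $\mu_0,\dots,\mu_n$ and $\mathbb{A}'(\mathcal{T})$ is the following algebra; $\mathcal{V}(\mathbb{A}'(\mathcal{T}))$ is the variety it generates, whose members interpret the same operation symbols; $\le$ denotes the meet-semilattice order ($x\le y$ iff $x\wedge y=x$). Let $U=\{1,2,H\}$, $W=\{C,D,\partial C,\partial D\}$, $A=\{0\}\cup U\cup W$; for $0\le i\le n$ and $r,s\in\{0,1\}$ let $V_{ir}^s=\{C_{ir}^s,D_{ir}^s,M_i^r,\partial C_{ir}^s,\partial D_{ir}^s,\partial M_i^r\}$, $V_{ir}=V_{ir}^0\cup V_{ir}^1$, $V_i=V_{i0}\cup V_{i1}$, $V=\bigcup_i V_i$ (all symbols distinct). The universe is $A\cup V$. $\partial$ denotes the involution of $V\cup W$ exchanging $x$ and $\partial x$; it is not an operation. Fundamental operations: - constant $0$ and $\wedge$ making a flat meet semilattice with bottom $0$; for $p,q$ each equal to $x$ or $0$, $p\vee q$ is their join. - multiplication: $2\cdot D=H\cdot C=D$, $1\cdot C=C$, $2\cdot\partial D=H\cdot\partial C=\partial D$, $1\cdot\partial C=\partial C$, else $0$. - $J(x,y,z)=x$ if $x=y$; $x\wedge z$ if $x=\partial y\in V\cup W$; $0$ otherwise. $J'(x,y,z)=x\wedge z$ if $x=y$; $x$ if $x=\partial y\in V\cup W$; $0$ otherwise. $K(x,y,z)=y$ if $x=\partial y\in V\cup W$; $z$ if $x=y=\partial z\in V\cup W$; $x\wedge y\wedge z$ otherwise. - $S_0(u,x,y,z)=(x\wedge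 y)\vee(x\wedge z)$ if $u\in V_0$, else $0$; $S_1(u,x,y,z)=(x\wedge y)\vee(x\wedge z)$ if $u\in\{1,2\}$, else $0$; $S_2(u,v,x,y,z)=(x\wedge y)\vee(x\wedge z)$ if $u=\partial v\in V\cup W$, else $0$. - $T(w,x,y,z)=w\cdot x$ if $w\cdot x=y\cdot z$ and $(w,x)=(y,z)$; $\partial(w\cdot x)$ if $w\cdot x=y\cdot z\ne0$ and $(w,x)\ne(y,z)$; $0$ otherwise. - $I(x)=C_{10}^0$ if $x=1$, $M_1^0$ if $x=H$, $D_{10}^0$ if $x=2$, else $0$. - for each instruction $(\mu_i,r,s,\mathrm{L},\mu_j)$ of $\mathcal{T}$ and $t\in\{0,1\}$: $L_{irt}(x,y,u)=C_{jt}^{s'}$ if $x=y=1$, $u=C_{ir}^{s'}$; $M_j^t$ if $x=H,y=1,u=C_{ir}^t$; $D_{jt}^s$ if $x=2,y=H,u=M_i^r$; $D_{jt}^{s'}$ if $x=y=2,u=D_{ir}^{s'}$; $\partial v$ if $u\in V$ and $L_{irt}(x,y,\partial u)=v\in V$ by the preceding clauses; $0$ otherwise. - for each instruction $(\mu_i,r,s,\mathrm{R},\mu_j)$ and $t\in\{0,1\}$: $R_{irt}(x,y,u)=C_{jt}^{s'}$ if $x=y=1,u=C_{ir}^{s'}$; $C_{jt}^s$ if $x=H,y=1,u=M_i^r$; $M_j^t$ if $x=2,y=H,u=D_{ir}^t$; $D_{jt}^{s'}$ if $x=y=2,u=D_{ir}^{s'}$; $\partial v$ if $u\in V$ and $R_{irt}(x,y,\partial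 u)=v\in V$ by the preceding clauses; $0$ otherwise. - with $\mathcal{L},\mathcal{R}$ the sets of these operations and $x\prec y$ iff $(x,y)\in\{(2,2),(2,H),(1,1)\}$, for each $F\in\mathcal{L}\cup\mathcal{R}$: $U_F^1(x,y,z,u)=\partial F(x,y,u)$ if $x\prec z,y\ne z,F(x,y,u)\ne0$; $F(x,y,u)$ if $x\prec z,y=z,F(x,y,u)\ne0$; $0$ otherwise; and $U_F^0(x,y,z,u)=\partial F(y,z,u)$ if $x\prec z,x\ne y,F(y,z,u)\ne0$; $F(y,z,u)$ if $x\prec z,x=y,F(y,z,u)\ne0$; $0$ otherwise. Terms: $e_0(m,x)=S_0(m,x,x,x)$, $e_1(m,x)=S_1(m,x,x,x)$, $e_2(m,n,x)=S_2(m,n,x,x,x)$. -}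

module Defs where

open import Data.Nat using (ℕ; zero; suc)
open import Data.Fin using (Fin; zero; suc)
import Data.Fin.Properties as FinP
open import Data.Bool using (Bool; true; false; if_then_else_; _∧_; not)
import Data.Bool.Properties as BoolP
open import Data.Maybe using (Maybe; just; nothing; maybe)
open import Data.Vec using (Vec; []; _∷_; lookup; map)
open import Data.Product using (Σ; _,_; proj₁; proj₂)
open import Relation.Binary.PropositionalEquality using (_≡_)
open import Relation.Nullary using (does)

-- Bits (tape symbols 0/1): false = 0, true = 1

Bit : Set
Bit = Bool

eqB : Bool → Bool → Bool
eqB a b = does (a BoolP.≟ b)

eqF : ∀ {N} → Fin N → Fin N → Bool
eqF i j = does (i FinP.≟ j)

isZeroF : ∀ {N} → Fin N → Bool
isZeroF zero = true
isZeroF (suc _) = false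

-- Turing machines.  States μ_0 … μ_n are Fin (suc n); we require n ≥ 1
-- (μ_1 is used by the operation I), so the number of states is 2 + m.

data Dir : Set where
  Lft Rgt : Dir

record Instr (N : ℕ) : Set where
  constructor instr
  field
    from  : Fin N
    read  : Bit
    write : Bit
    dir   : Dir
    to    : Fin N

record TM : Set where
  field
    m      : ℕ                       -- n = m + 1
    k      : ℕ
    instrs : Fin k → Instr (suc (suc m))

  N : ℕ
  N = suc (suc m)

open TM public

-- The universe of A'(T).  A point of V ∪ W is a "base" point together
-- with a polarity: false = x, true = ∂x.

data Pt (N : ℕ) : Set where
  cW dW : Pt N
  cV    : Fin N → Bit → Bit → Pt N    -- C_{ir}^s
  dV    : Fin N → Bit → Bit → Pt N    -- D_{ir}^s
  mV    : Fin N → Bit → Pt N          -- M_i^r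

data El (N : ℕ) : Set where
  ο one two H : El N
  pt : Bool → Pt N → El N

module _ {N : ℕ} where

  eqP : Pt N → Pt N → Bool
  eqP cW cW = true
  eqP dW dW = true
  eqP (cV i r s) (cV i' r' s') = eqF i i' ∧ (eqB r r' ∧ eqB s s')
  eqP (dV i r s) (dV i' r' s') = eqF i i' ∧ (eqB r r' ∧ eqB s s')
  eqP (mV i r) (mV i' r') = eqF i i' ∧ eqB r r'
  eqP _ _ = false

  eqE : El N → El N → Bool
  eqE ο ο = true
  eqE one one = true
  eqE two two = true
  eqE H H = true
  eqE (pt b p) (pt b' p') = eqB b b' ∧ eqP p p'
  eqE _ _ = false

  opp : El N → El N → Bool
  opp (pt b p) (pt b' p') = not (eqB b b') ∧ eqP p p'
  opp _ _ = false

  -- the involution ∂ (only applied to elements of V ∪ W)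
  dual : El N → El N
  dual (pt b p) = pt (not b) p
  dual x = x

  meet : El N → El N → El N
  meet x y = if eqE x y then x else ο

  -- join p ∨ q for p , q ∈ {x , 0}
  join : El N → El N → El N
  join p q = if eqE p ο then q else p

  mult : El N → El N → El N
  mult two (pt b dW) = pt b dW
  mult H   (pt b cW) = pt b dW
  mult one (pt b cW) = pt b cW
  mult _ _ = ο

  opJ : El N → El N → El N → El N
  opJ x y z = if eqE x y then x else (if opp x y then meet x z else ο)

  opJ' : El N → El N → El N → El N
  opJ' x y z = if eqE x y then meet x z else (if opp x y then x else ο)

  opK : El N → El N → El N → El N
  opK x y z = if opp x y then y
              else (if eqE x y ∧ opp y z then z else meet x (meet y z))

  inV0 : El N → Bool
  inV0 (pt _ (cV i _ _)) = isZeroF i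
  inV0 (pt _ (dV i _ _)) = isZeroF i
  inV0 (pt _ (mV i _)) = isZeroF i
  inV0 _ = false

  in12 : El N → Bool
  in12 one = true
  in12 two = true
  in12 _ = false

  opS0 : El N → El N → El N → El N → El N
  opS0 u x y z = if inV0 u then join (meet x y) (meet x z) else ο

  opS1 : El N → El N → El N → El N → El N
  opS1 u x y z = if in12 u then join (meet x y) (meet x z) else ο

  opS2 : El N → El N → El N → El N → El N → El N
  opS2 u v x y z = if opp u v then join (meet x y) (meet x z) else ο

  opT : El N → El N → El N → El N → El N
  opT w x y z =
    if eqE (mult w x) (mult y z)
    then (if eqE w y ∧ eqE x z then mult w x
          else (if eqE (mult w x) ο then ο else dual (mult w x)))
    else ο

  FLbase : Instr N → Bit → El N → El N → Pt N → Maybe (Pt N)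
  FLbase (instr i r s _ j) t one one (cV i' r' s') =
    if eqF i' i ∧ eqB r' r then just (cV j t s') else nothing
  FLbase (instr i r s _ j) t H one (cV i' r' s') =
    if eqF i' i ∧ (eqB r' r ∧ eqB s' t) then just (mV j t) else nothing
  FLbase (instr i r s _ j) t two H (mV i' r') =
    if eqF i' i ∧ eqB r' r then just (dV j t s) else nothing
  FLbase (instr i r s _ j) t two two (dV i' r' s') =
    if eqF i' i ∧ eqB r' r then just (dV j t s') else nothing
  FLbase _ _ _ _ _ = nothing

  FRbase : Instr N → Bit → El N → El N → Pt N → Maybe (Pt N)
  FRbase (instr i r s _ j) t one one (cV i' r' s') =
    if eqF i' i ∧ eqB r' r then just (cV j t s') else nothing
  FRbase (instr i r s _ j) t H one (mV i' r') =
    if eqF i' i ∧ eqB r' r then just (cV j t s) else nothing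
  FRbase (instr i r s _ j) t two H (dV i' r' s') =
    if eqF i' i ∧ (eqB r' r ∧ eqB s' t) then just (mV j t) else nothing
  FRbase (instr i r s _ j) t two two (dV i' r' s') =
    if eqF i' i ∧ eqB r' r then just (dV j t s') else nothing
  FRbase _ _ _ _ _ = nothing

  Fbase : Instr N → Bit → El N → El N → Pt N → Maybe (Pt N)
  Fbase ins with Instr.dir ins
  ... | Lft = FLbase ins
  ... | Rgt = FRbase ins

  -- L_{irt} / R_{irt}: base clauses on u ∈ V, and the ∂-clause
  -- F(x,y,∂u) = ∂ F(x,y,u) (base clauses only fire on elements of V).
  opF : Instr N → Bit → El N → El N → El N → El N
  opF ins t x y (pt b p) = maybe (pt b) ο (Fbase ins t x y p)
  opF ins t x y _ = ο

  prec : El N → El N → Bool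
  prec two two = true
  prec two H = true
  prec one one = true
  prec _ _ = false

  opU1 : Instr N → Bit → El N → El N → El N → El N → El N
  opU1 ins t x y z u =
    if prec x z
    then (if eqE (opF ins t x y u) ο then ο
          else (if eqE y z then opF ins t x y u else dual (opF ins t x y u)))
    else ο

  opU0 : Instr N → Bit → El N → El N → El N → El N → El N
  opU0 ins t x y z u =
    if prec x z
    then (if eqE (opF ins t y z u) ο then ο
          else (if eqE x y then opF ins t y z u else dual (opF ins t y z u)))
    else ο

opI : ∀ {m} → El (suc (suc m)) → El (suc (suc m))
opI one = pt false (cV (suc zero) false false)
opI H   = pt false (mV (suc zero) false)
opI two = pt false (dV (suc zero) false false)
opI _   = ο

data Op (k : ℕ) : Set where
  o0 oMeet oMult oJ oJ' oK oS0 oS1 oS2 oT oI : Op k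
  oF oU1 oU0 : Fin k → Bit → Op k

arity : ∀ {k} → Op k → ℕ
arity o0 = 0
arity oMeet = 2
arity oMult = 2
arity oJ = 3
arity oJ' = 3
arity oK = 3
arity oS0 = 4
arity oS1 = 4
arity oS2 = 5
arity oT = 4
arity oI = 1
arity (oF _ _) = 3
arity (oU1 _ _) = 4
arity (oU0 _ _) = 4

record Algebra (k : ℕ) : Set₁ where
  field
    Carrier : Set
    ⟦_⟧     : (o : Op k) → Vec Carrier (arity o) → Carrier

open Algebra public

A' : (T : TM) → Algebra (k T)
Carrier (A' T) = El (N T)
⟦ A' T ⟧ o0 [] = ο
⟦ A' T ⟧ oMeet (x ∷ y ∷ []) = meet x y
⟦ A' T ⟧ oMult (x ∷ y ∷ []) = mult x y
⟦ A' T ⟧ oJ (x ∷ y ∷ z ∷ []) = opJ x y z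
⟦ A' T ⟧ oJ' (x ∷ y ∷ z ∷ []) = opJ' x y z
⟦ A' T ⟧ oK (x ∷ y ∷ z ∷ []) = opK x y z
⟦ A' T ⟧ oS0 (u ∷ x ∷ y ∷ z ∷ []) = opS0 u x y z
⟦ A' T ⟧ oS1 (u ∷ x ∷ y ∷ z ∷ []) = opS1 u x y z
⟦ A' T ⟧ oS2 (u ∷ v ∷ x ∷ y ∷ z ∷ []) = opS2 u v x y z
⟦ A' T ⟧ oT (w ∷ x ∷ y ∷ z ∷ []) = opT w x y z
⟦ A' T ⟧ oI (x ∷ []) = opI x
⟦ A' T ⟧ (oF q t) (x ∷ y ∷ u ∷ []) = opF (instrs T q) t x y u
⟦ A' T ⟧ (oU1 q t) (x ∷ y ∷ z ∷ u ∷ []) = opU1 (instrs T q) t x y z u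
⟦ A' T ⟧ (oU0 q t) (x ∷ y ∷ z ∷ u ∷ []) = opU0 (instrs T q) t x y z u

Pow : ∀ {k} → Algebra k → Set → Algebra k
Carrier (Pow A I) = I → Carrier A
⟦ Pow A I ⟧ o xs = λ i → ⟦ A ⟧ o (map (λ f → f i) xs)

-- B ∈ V(A) = HSP(A): B is a homomorphic image of a subalgebra of a
-- direct power of A.
record InHSP {k} (A : Algebra k) (B : Algebra k) : Set₁ where
  field
    I      : Set
    P      : (I → Carrier A) → Set
    closed : ∀ (o : Op k) (xs : Vec (Σ (I → Carrier A) P) (arity o))
             → P (⟦ Pow A I ⟧ o (map proj₁ xs))
    h      : Σ (I → Carrier A) P → Carrier B
    h-ext  : ∀ a b → (∀ i → proj₁ a i ≡ proj₁ b i) → h a ≡ h b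
    h-hom  : ∀ (o : Op k) (xs : Vec (Σ (I → Carrier A) P) (arity o))
             → h (⟦ Pow A I ⟧ o (map proj₁ xs) , closed o xs) ≡ ⟦ B ⟧ o (map h xs)
    h-surj : ∀ b → Σ (Σ (I → Carrier A) P) (λ a → h a ≡ b)

data Cg {k} (B : Algebra k) (c d : Carrier B) : Carrier B → Carrier B → Set where
  cg-gen   : Cg B c d c d
  cg-refl  : ∀ {x} → Cg B c d x x
  cg-sym   : ∀ {x y} → Cg B c d x y → Cg B c d y x
  cg-trans : ∀ {x y z} → Cg B c d x y → Cg B c d y z → Cg B c d x z
  cg-compat : ∀ (o : Op k) (xs ys : Vec (Carrier B) (arity o))
              → (∀ j → Cg B c d (lookup xs j) (lookup ys j))
              → Cg B c d (⟦ B ⟧ o xs) (⟦ B ⟧ o ys)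

module _ {k : ℕ} (B : Algebra k) where
  ∧B : Carrier B → Carrier B → Carrier B
  ∧B x y = ⟦ B ⟧ oMeet (x ∷ y ∷ [])

  Leq : Carrier B → Carrier B → Set
  Leq x y = ∧B x y ≡ x

  JB J'B : Carrier B → Carrier B → Carrier B → Carrier B
  JB x y z = ⟦ B ⟧ oJ (x ∷ y ∷ z ∷ [])
  J'B x y z = ⟦ B ⟧ oJ' (x ∷ y ∷ z ∷ [])

  e0 e1 : Carrier B → Carrier B → Carrier B
  e0 m x = ⟦ B ⟧ oS0 (m ∷ x ∷ x ∷ x ∷ [])
  e1 m x = ⟦ B ⟧ oS1 (m ∷ x ∷ x ∷ x ∷ [])

  e2 : Carrier B → Carrier B → Carrier B → Carrier B
  e2 m n x = ⟦ B ⟧ oS2 (m ∷ n ∷ x ∷ x ∷ x ∷ [])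

  -- a choice of i ∈ {0,1,2} together with n̄
  data EChoice : Set where
    ch0 ch1 : Carrier B → EChoice
    ch2     : Carrier B → Carrier B → EChoice

  eApp : EChoice → Carrier B → Carrier B
  eApp (ch0 n) x = e0 n x
  eApp (ch1 n) x = e1 n x
  eApp (ch2 m n) x = e2 m n x

-- The hypotheses are not identities, so they cannot be verified in A'(T)
-- and transferred directly.  Instead the proof isolates five IDENTITIES
-- (record 'SatisfiesLaws'): associativity of ∧, an absorption law for
-- J/J', and three laws about the elements built from J, J', K, e_i and e₂
-- that occur in the statement.
module Submission where

open import Defs
open import Data.Nat using (ℕ)
open import Data.Fin using (Fin; #_)
import Data.Fin.Properties as FinP
open import Data.Bool using (true; false; if_then_else_; _∧_)
import Data.Bool.Properties as BoolP
open import Data.Vec using (Vec; []; _∷_; lookup; map)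
open import Data.Product using (Σ; _×_; _,_; proj₁; proj₂)
open import Data.Sum using (_⊎_; inj₁; inj₂)
open import Relation.Binary.PropositionalEquality
  using (_≡_; refl; sym; trans; cong; cong₂; subst; module ≡-Reasoning)
open import Relation.Nullary using (Dec; does; yes)
open import Relation.Nullary.Decidable using (dec-true)

module Laws {k : ℕ} (C : Algebra k) where

  KB : Carrier C → Carrier C → Carrier C → Carrier C
  KB x y z = ⟦ C ⟧ oK (x ∷ y ∷ z ∷ [])

  -- K(R,q₁,K(p₂,q₂,q₁)): the witness ρ of the lemma.
  pivot : Carrier C → Carrier C → Carrier C → Carrier C → Carrier C
  pivot R q₁ p₂ q₂ = KB R q₁ (KB p₂ q₂ q₁)

  -- J(p₁,q₁,a) ∧ J'(p₁,q₁,J'(p₂,q₂,e_i(n̄,J(p₁,q₁,b)))); under the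
  -- hypotheses of the lemma it equals r (for a = r, b = t).
  sandwich : EChoice C → (a b p₁ q₁ p₂ q₂ : Carrier C) → Carrier C
  sandwich n̄ a b p₁ q₁ p₂ q₂ =
    ∧B C (JB C p₁ q₁ a) (J'B C p₁ q₁ (J'B C p₂ q₂ (eApp C n̄ (JB C p₁ q₁ b))))

  fixJ' : EChoice C → Carrier C → Carrier C → Carrier C
  fixJ' n̄ a ρ = J'B C a ρ (eApp C n̄ a)

  -- J'(R,ρ,e_i(n̄,s ∧ R)): the witness u of the lemma (for R = r).
  lower : EChoice C → Carrier C → Carrier C → Carrier C → Carrier C
  lower n̄ R ρ s = J'B C R ρ (eApp C n̄ (∧B C s R))

  -- ∧ is associative (so that ≤ is transitive)
  MeetAssociative : Set
  MeetAssociative = ∀ x y z → ∧B C (∧B C x y) z ≡ ∧B C x (∧B C y z)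

  -- J'(p,q,-) returns J(p,q,b) to the top J(p,q,a): the step that
  -- collapses the sandwich element to r
  JJ'Absorption : Set
  JJ'Absorption = ∀ p q a b → ∧B C (JB C p q a) (J'B C p q (JB C p q b)) ≡ JB C p q a

  PivotFixes : Set
  PivotFixes = ∀ n̄ a b p₁ q₁ p₂ q₂ →
    let R = sandwich n̄ a b p₁ q₁ p₂ q₂ in
    R ≡ J'B C R (pivot R q₁ p₂ q₂) (eApp C n̄ R)

  LowerFixed : Set
  LowerFixed = ∀ n̄ a ρ s →
    let R = fixJ' n̄ a ρ ; U = lower n̄ R ρ s in
    U ≡ JB C U ρ (e2 C R ρ R)

  MeetFixed : Set
  MeetFixed = ∀ n̄ a ρ s →
    let R = fixJ' n̄ a ρ ; U = lower n̄ R ρ s in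
    ∧B C s R ≡ JB C U ρ (e2 C R ρ (∧B C s R))

record SatisfiesLaws {k : ℕ} (C : Algebra k) : Set where
  open Laws C
  field
    ∧-assoc       : MeetAssociative
    jj'-absorb    : JJ'Absorption
    pivot-fixes   : PivotFixes
    lower-fixed   : LowerFixed
    meet-fixed    : MeetFixed

-- Terms, and preservation of identities under HSP.

data Term (K V : ℕ) : Set where
  var : Fin V → Term K V
  app : (o : Op K) → Vec (Term K V) (arity o) → Term K V

-- Terms form an algebra, so terms can be written with the named
-- operations (∧B, JB, eApp, ...) of the signature.
TermAlg : (K V : ℕ) → Algebra K
Carrier (TermAlg K V) = Term K V
⟦ TermAlg K V ⟧ = app

module _ {K : ℕ} (C : Algebra K) {V : ℕ} where

  eval : (Fin V → Carrier C) → Term K V → Carrier C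
  evals : ∀ {n} → (Fin V → Carrier C) → Vec (Term K V) n → Vec (Carrier C) n
  eval env (var v) = env v
  eval env (app o ts) = ⟦ C ⟧ o (evals env ts)
  evals env [] = []
  evals env (t ∷ ts) = eval env t ∷ evals env ts

  eval-ext : ∀ {env env′} → (∀ v → env v ≡ env′ v) → ∀ t → eval env t ≡ eval env′ t
  evals-ext : ∀ {env env′} → (∀ v → env v ≡ env′ v) →
              ∀ {n} (ts : Vec (Term K V) n) → evals env ts ≡ evals env′ ts
  eval-ext eq (var v) = eq v
  eval-ext eq (app o ts) = cong (⟦ C ⟧ o) (evals-ext eq ts)
  evals-ext eq [] = refl
  evals-ext eq (t ∷ ts) = cong₂ _∷_ (eval-ext eq t) (evals-ext eq ts)

  Identity : Term K V → Term K V → Set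
  Identity t u = ∀ env → eval env t ≡ eval env u

module Preservation {K : ℕ} {A B : Algebra K} (hsp : InHSP A B) {V : ℕ} where
  open InHSP hsp

  Sub : Set
  Sub = Σ (I → Carrier A) P

  evalSub : (Fin V → Sub) → Term K V → Sub
  evalSubs : ∀ {n} → (Fin V → Sub) → Vec (Term K V) n → Vec Sub n
  evalSub env (var v) = env v
  evalSub env (app o ts) =
    ⟦ Pow A I ⟧ o (map proj₁ (evalSubs env ts)) , closed o (evalSubs env ts)
  evalSubs env [] = []
  evalSubs env (t ∷ ts) = evalSub env t ∷ evalSubs env ts

  h-eval : ∀ env t → h (evalSub env t) ≡ eval B (λ v → h (env v)) t
  h-evals : ∀ env {n} (ts : Vec (Term K V) n) →
            map h (evalSubs env ts) ≡ evals B (λ v → h (env v)) ts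
  h-eval env (var v) = refl
  h-eval env (app o ts) = trans (h-hom o (evalSubs env ts)) (cong (⟦ B ⟧ o) (h-evals env ts))
  h-evals env [] = refl
  h-evals env (t ∷ ts) = cong₂ _∷_ (h-eval env t) (h-evals env ts)

  coord-eval : ∀ env t i → proj₁ (evalSub env t) i ≡ eval A (λ v → proj₁ (env v) i) t
  coord-evals : ∀ env {n} (ts : Vec (Term K V) n) i →
                map (λ f → f i) (map proj₁ (evalSubs env ts)) ≡ evals A (λ v → proj₁ (env v) i) ts
  coord-eval env (var v) i = refl
  coord-eval env (app o ts) i = cong (⟦ A ⟧ o) (coord-evals env ts i)
  coord-evals env [] i = refl
  coord-evals env (t ∷ ts) i = cong₂ _∷_ (coord-eval env t i) (coord-evals env ts i)

  -- Identities of A hold in B: lift the environment along the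
  -- surjection h, compare coordinatewise in A^I, and push back along h.
  preserves : (t u : Term K V) → Identity A t u → Identity B t u
  preserves t u holdsA env = begin
    eval B env t               ≡⟨ eval-ext B (λ v → sym (lift-h v)) t ⟩
    eval B (λ v → h (lift v)) t ≡⟨ sym (h-eval lift t) ⟩
    h (evalSub lift t)          ≡⟨ h-ext _ _ coordinatewise ⟩
    h (evalSub lift u)          ≡⟨ h-eval lift u ⟩
    eval B (λ v → h (lift v)) u ≡⟨ eval-ext B lift-h u ⟩
    eval B env u               ∎
    where
      open ≡-Reasoning
      lift : Fin V → Sub
      lift v = proj₁ (h-surj (env v))
      lift-h : ∀ v → h (lift v) ≡ env v
      lift-h v = proj₂ (h-surj (env v))
      coordinatewise : ∀ i → proj₁ (evalSub lift t) i ≡ proj₁ (evalSub lift u) i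
      coordinatewise i =
        trans (coord-eval lift t i) (trans (holdsA _) (sym (coord-eval lift u i)))

-- A law mentioning e_i(n̄,-) is instantiated once for each shape of n̄,
-- the parameters of n̄ becoming the last variables of the identity.
module _ {K : ℕ} {A B : Algebra K} (hsp : InHSP A B) (lawsA : SatisfiesLaws A) where
  open SatisfiesLaws lawsA
  open Preservation hsp

  private
    x : ∀ {V} → Fin V → Term K V
    x = var

    module L₅ = Laws (TermAlg K 5)
    module L₈ = Laws (TermAlg K 8)

    pivot-lhs pivot-rhs : EChoice (TermAlg K 8) → Term K 8
    pivot-lhs c = L₈.sandwich c (x (# 0)) (x (# 1)) (x (# 2)) (x (# 3)) (x (# 4)) (x (# 5))
    pivot-rhs c = J'B (TermAlg K 8) (pivot-lhs c)
      (L₈.pivot (pivot-lhs c) (x (# 3)) (x (# 4)) (x (# 5))) (eApp (TermAlg K 8) c (pivot-lhs c))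

    pivot-in-A : (n̄ : EChoice A) (ε : Fin 8 → Carrier A) →
      let open Laws A ; R = sandwich n̄ (ε (# 0)) (ε (# 1)) (ε (# 2)) (ε (# 3)) (ε (# 4)) (ε (# 5)) in
      R ≡ J'B A R (pivot R (ε (# 3)) (ε (# 4)) (ε (# 5))) (eApp A n̄ R)
    pivot-in-A n̄ ε = pivot-fixes n̄ (ε (# 0)) (ε (# 1)) (ε (# 2)) (ε (# 3)) (ε (# 4)) (ε (# 5))

    R₅ U₅ : EChoice (TermAlg K 5) → Term K 5
    R₅ c = L₅.fixJ' c (x (# 0)) (x (# 1))
    U₅ c = L₅.lower c (R₅ c) (x (# 1)) (x (# 2))

    lower-rhs meet-lhs meet-rhs : EChoice (TermAlg K 5) → Term K 5
    lower-rhs c = JB (TermAlg K 5) (U₅ c) (x (# 1)) (e2 (TermAlg K 5) (R₅ c) (x (# 1)) (R₅ c))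
    meet-lhs c = ∧B (TermAlg K 5) (x (# 2)) (R₅ c)
    meet-rhs c = JB (TermAlg K 5) (U₅ c) (x (# 1)) (e2 (TermAlg K 5) (R₅ c) (x (# 1)) (meet-lhs c))

  meet-assoc-B : Laws.MeetAssociative B
  meet-assoc-B a b c =
    preserves (∧B 𝕋 (∧B 𝕋 (x (# 0)) (x (# 1))) (x (# 2))) (∧B 𝕋 (x (# 0)) (∧B 𝕋 (x (# 1)) (x (# 2))))
              (λ ε → ∧-assoc (ε (# 0)) (ε (# 1)) (ε (# 2)))
              (lookup (a ∷ b ∷ c ∷ []))
    where 𝕋 : Algebra K
          𝕋 = TermAlg K 3

  jj'-absorb-B : Laws.JJ'Absorption B
  jj'-absorb-B p q a b =
    preserves (∧B 𝕋 (JB 𝕋 (x (# 0)) (x (# 1)) (x (# 2))) (J'B 𝕋 (x (# 0)) (x (# 1)) (JB 𝕋 (x (# 0)) (x (# 1)) (x (# 3)))))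
              (JB 𝕋 (x (# 0)) (x (# 1)) (x (# 2)))
              (λ ε → jj'-absorb (ε (# 0)) (ε (# 1)) (ε (# 2)) (ε (# 3)))
              (lookup (p ∷ q ∷ a ∷ b ∷ []))
    where 𝕋 : Algebra K
          𝕋 = TermAlg K 4

  pivot-fixes-B : Laws.PivotFixes B
  pivot-fixes-B (ch0 m) a b p₁ q₁ p₂ q₂ =
    preserves (pivot-lhs c) (pivot-rhs c) (λ ε → pivot-in-A (ch0 (ε (# 6))) ε)
      (lookup (a ∷ b ∷ p₁ ∷ q₁ ∷ p₂ ∷ q₂ ∷ m ∷ m ∷ []))
    where c : EChoice (TermAlg K 8)
          c = ch0 (x (# 6))
  pivot-fixes-B (ch1 m) a b p₁ q₁ p₂ q₂ =
    preserves (pivot-lhs c) (pivot-rhs c) (λ ε → pivot-in-A (ch1 (ε (# 6))) ε)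
      (lookup (a ∷ b ∷ p₁ ∷ q₁ ∷ p₂ ∷ q₂ ∷ m ∷ m ∷ []))
    where c : EChoice (TermAlg K 8)
          c = ch1 (x (# 6))
  pivot-fixes-B (ch2 m m′) a b p₁ q₁ p₂ q₂ =
    preserves (pivot-lhs c) (pivot-rhs c) (λ ε → pivot-in-A (ch2 (ε (# 6)) (ε (# 7))) ε)
      (lookup (a ∷ b ∷ p₁ ∷ q₁ ∷ p₂ ∷ q₂ ∷ m ∷ m′ ∷ []))
    where c : EChoice (TermAlg K 8)
          c = ch2 (x (# 6)) (x (# 7))

  lower-fixed-B : Laws.LowerFixed B
  lower-fixed-B (ch0 m) a ρ s =
    preserves (U₅ c) (lower-rhs c) (λ ε → lower-fixed (ch0 (ε (# 3))) (ε (# 0)) (ε (# 1)) (ε (# 2)))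
      (lookup (a ∷ ρ ∷ s ∷ m ∷ m ∷ []))
    where c : EChoice (TermAlg K 5)
          c = ch0 (x (# 3))
  lower-fixed-B (ch1 m) a ρ s =
    preserves (U₅ c) (lower-rhs c) (λ ε → lower-fixed (ch1 (ε (# 3))) (ε (# 0)) (ε (# 1)) (ε (# 2)))
      (lookup (a ∷ ρ ∷ s ∷ m ∷ m ∷ []))
    where c : EChoice (TermAlg K 5)
          c = ch1 (x (# 3))
  lower-fixed-B (ch2 m m′) a ρ s =
    preserves (U₅ c) (lower-rhs c) (λ ε → lower-fixed (ch2 (ε (# 3)) (ε (# 4))) (ε (# 0)) (ε (# 1)) (ε (# 2)))
      (lookup (a ∷ ρ ∷ s ∷ m ∷ m′ ∷ []))
    where c : EChoice (TermAlg K 5)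
          c = ch2 (x (# 3)) (x (# 4))

  meet-fixed-B : Laws.MeetFixed B
  meet-fixed-B (ch0 m) a ρ s =
    preserves (meet-lhs c) (meet-rhs c) (λ ε → meet-fixed (ch0 (ε (# 3))) (ε (# 0)) (ε (# 1)) (ε (# 2)))
      (lookup (a ∷ ρ ∷ s ∷ m ∷ m ∷ []))
    where c : EChoice (TermAlg K 5)
          c = ch0 (x (# 3))
  meet-fixed-B (ch1 m) a ρ s =
    preserves (meet-lhs c) (meet-rhs c) (λ ε → meet-fixed (ch1 (ε (# 3))) (ε (# 0)) (ε (# 1)) (ε (# 2)))
      (lookup (a ∷ ρ ∷ s ∷ m ∷ m ∷ []))
    where c : EChoice (TermAlg K 5)
          c = ch1 (x (# 3))
  meet-fixed-B (ch2 m m′) a ρ s =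
    preserves (meet-lhs c) (meet-rhs c) (λ ε → meet-fixed (ch2 (ε (# 3)) (ε (# 4))) (ε (# 0)) (ε (# 1)) (ε (# 2)))
      (lookup (a ∷ ρ ∷ s ∷ m ∷ m′ ∷ []))
    where c : EChoice (TermAlg K 5)
          c = ch2 (x (# 3)) (x (# 4))

  preserve-laws : SatisfiesLaws B
  preserve-laws = record
    { ∧-assoc = meet-assoc-B
    ; jj'-absorb = jj'-absorb-B
    ; pivot-fixes = pivot-fixes-B
    ; lower-fixed = lower-fixed-B
    ; meet-fixed = meet-fixed-B
    }

-- Element-level facts about A'(T).

does-sound : ∀ {a} {P : Set a} (p? : Dec P) → does p? ≡ true → P
does-sound (yes p) _ = p

∧-true : ∀ {a b} → a ∧ b ≡ true → (a ≡ true) × (b ≡ true)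
∧-true {true} {true} _ = refl , refl

∧-true₃ : ∀ {a b c} → a ∧ (b ∧ c) ≡ true → (a ≡ true) × (b ≡ true) × (c ≡ true)
∧-true₃ {true} {true} {true} _ = refl , refl , refl

eqB-refl : ∀ b → eqB b b ≡ true
eqB-refl b = dec-true (b BoolP.≟ b) refl

eqB-sound : ∀ {b c} → eqB b c ≡ true → b ≡ c
eqB-sound {b} {c} = does-sound (b BoolP.≟ c)

eqF-refl : ∀ {n} (i : Fin n) → eqF i i ≡ true
eqF-refl i = dec-true (i FinP.≟ i) refl

eqF-sound : ∀ {n} {i j : Fin n} → eqF i j ≡ true → i ≡ j
eqF-sound {i = i} {j} = does-sound (i FinP.≟ j)

module _ {N : ℕ} where

  eqP-refl : (p : Pt N) → eqP p p ≡ true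
  eqP-refl cW = refl
  eqP-refl dW = refl
  eqP-refl (cV i r s) rewrite eqF-refl i | eqB-refl r | eqB-refl s = refl
  eqP-refl (dV i r s) rewrite eqF-refl i | eqB-refl r | eqB-refl s = refl
  eqP-refl (mV i r) rewrite eqF-refl i | eqB-refl r = refl

  eqP-sound : ∀ {p q : Pt N} → eqP p q ≡ true → p ≡ q
  eqP-sound {cW} {cW} _ = refl
  eqP-sound {dW} {dW} _ = refl
  eqP-sound {cV i r s} {cV i′ r′ s′} e
    with ei , er , es ← ∧-true₃ {eqF i i′} {eqB r r′} {eqB s s′} e
    rewrite eqF-sound {i = i} {i′} ei | eqB-sound {r} {r′} er | eqB-sound {s} {s′} es = refl
  eqP-sound {dV i r s} {dV i′ r′ s′} e
    with ei , er , es ← ∧-true₃ {eqF i i′} {eqB r r′} {eqB s s′} e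
    rewrite eqF-sound {i = i} {i′} ei | eqB-sound {r} {r′} er | eqB-sound {s} {s′} es = refl
  eqP-sound {mV i r} {mV i′ r′} e
    with ei , er ← ∧-true {eqF i i′} {eqB r r′} e
    rewrite eqF-sound {i = i} {i′} ei | eqB-sound {r} {r′} er = refl

  eqE-refl : (x : El N) → eqE x x ≡ true
  eqE-refl ο = refl
  eqE-refl one = refl
  eqE-refl two = refl
  eqE-refl H = refl
  eqE-refl (pt b p) rewrite eqB-refl b | eqP-refl p = refl

  eqE-sound : ∀ {x y : El N} → eqE x y ≡ true → x ≡ y
  eqE-sound {ο} {ο} _ = refl
  eqE-sound {one} {one} _ = refl
  eqE-sound {two} {two} _ = refl
  eqE-sound {H} {H} _ = refl
  eqE-sound {pt b p} {pt b′ p′} e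
    with eb , ep ← ∧-true {eqB b b′} {eqP p p′} e
    rewrite eqB-sound {b} {b′} eb | eqP-sound {p} {p′} ep = refl

  opp-irrefl : (x : El N) → opp x x ≡ false
  opp-irrefl (pt b p) rewrite eqB-refl b = refl
  opp-irrefl ο = refl
  opp-irrefl one = refl
  opp-irrefl two = refl
  opp-irrefl H = refl

  opp⇒distinct : ∀ {x y : El N} → opp x y ≡ true → eqE x y ≡ false
  opp⇒distinct {pt false p} {pt true p′} _ = refl
  opp⇒distinct {pt true p} {pt false p′} _ = refl

  -- the three ways two elements can compare: J, J', K distinguish them
  data Comparison (x y : El N) : Set where
    same     : x ≡ y → Comparison x y
    opposite : opp x y ≡ true → Comparison x y
    apart    : eqE x y ≡ false → opp x y ≡ false → Comparison x y

  compare : (x y : El N) → Comparison x y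
  compare x y with eqE x y in e₁ | opp x y in e₂
  ... | true  | _     = same (eqE-sound e₁)
  ... | false | true  = opposite e₂
  ... | false | false = apart e₁ e₂

  meet-idem : (x : El N) → meet x x ≡ x
  meet-idem x rewrite eqE-refl x = refl

  meet-zeroˡ : (x : El N) → meet ο x ≡ ο
  meet-zeroˡ x with eqE ο x
  ... | true = refl
  ... | false = refl

  meet-zeroʳ : (x : El N) → meet x ο ≡ ο
  meet-zeroʳ x with eqE x ο in e
  ... | true = eqE-sound e
  ... | false = refl

  meet-flat : (x y : El N) → (meet x y ≡ ο) ⊎ (x ≡ y)
  meet-flat x y with eqE x y in e
  ... | true = inj₂ (eqE-sound e)
  ... | false = inj₁ refl

  meet-elim : (P : El N → Set) → P ο → ∀ x y → (x ≡ y → P x) → P (meet x y)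
  meet-elim P P0 x y Px with meet-flat x y
  ... | inj₁ e = subst P (sym e) P0
  ... | inj₂ refl = subst P (sym (meet-idem x)) (Px refl)

  meet-comm : (x y : El N) → meet x y ≡ meet y x
  meet-comm x y with meet-flat x y | meet-flat y x
  ... | inj₂ refl | _ = refl
  ... | _ | inj₂ refl = refl
  ... | inj₁ e | inj₁ e′ = trans e (sym e′)

  meet-absorb : (x y : El N) → meet x (meet x y) ≡ meet x y
  meet-absorb x y = meet-elim (λ z → meet x z ≡ z) (meet-zeroʳ x) x y (λ { refl → meet-idem x })

  meet-absorbʳ : (x y : El N) → meet x (meet y x) ≡ meet y x
  meet-absorbʳ x y = trans (cong (meet x) (meet-comm y x)) (trans (meet-absorb x y) (meet-comm x y))

  meet-assoc : (x y z : El N) → meet (meet x y) z ≡ meet x (meet y z)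
  meet-assoc x y z with meet-flat x y
  ... | inj₂ refl rewrite meet-idem x = sym (meet-absorb x z)
  ... | inj₁ xy rewrite xy | meet-zeroˡ z with meet-flat y z
  ...   | inj₁ yz rewrite yz = sym (meet-zeroʳ x)
  ...   | inj₂ refl rewrite meet-idem y = sym xy

  join-idem : (x : El N) → join x x ≡ x
  join-idem x with eqE x ο
  ... | true = refl
  ... | false = refl

  J-same : (x z : El N) → opJ x x z ≡ x
  J-same x z rewrite eqE-refl x = refl

  J-opposite : (x y z : El N) → opp x y ≡ true → opJ x y z ≡ meet x z
  J-opposite x y z d rewrite opp⇒distinct {x} {y} d | d = refl

  J-apart : (x y z : El N) → eqE x y ≡ false → opp x y ≡ false → opJ x y z ≡ ο
  J-apart x y z ne nd rewrite ne | nd = refl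

  J-zero : (y z : El N) → opJ ο y z ≡ ο
  J-zero y z with eqE ο y
  ... | true = refl
  ... | false = refl

  J'-same : (x z : El N) → opJ' x x z ≡ meet x z
  J'-same x z rewrite eqE-refl x = refl

  J'-opposite : (x y z : El N) → opp x y ≡ true → opJ' x y z ≡ x
  J'-opposite x y z d rewrite opp⇒distinct {x} {y} d | d = refl

  J'-apart : (x y z : El N) → eqE x y ≡ false → opp x y ≡ false → opJ' x y z ≡ ο
  J'-apart x y z ne nd rewrite ne | nd = refl

  J'-zero : (y z : El N) → opJ' ο y z ≡ ο
  J'-zero y z with eqE ο y
  ... | true = meet-zeroˡ z
  ... | false = refl

  K-opposite : (x y z : El N) → opp x y ≡ true → opK x y z ≡ y
  K-opposite x y z d rewrite d = refl

  K-diagonal-opposite : (x z : El N) → opp x z ≡ true → opK x x z ≡ z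
  K-diagonal-opposite x z d rewrite opp-irrefl x | eqE-refl x | d = refl

  K-diagonal : (x : El N) → opK x x x ≡ x
  K-diagonal x rewrite opp-irrefl x | eqE-refl x | meet-idem x = refl

  e2-opposite : (u v x : El N) → opp u v ≡ true → opS2 u v x x x ≡ x
  e2-opposite u v x d rewrite d | meet-idem x = join-idem x

  e2-diagonal : (u x : El N) → opS2 u u x x x ≡ ο
  e2-diagonal u x rewrite opp-irrefl u = refl

  -- every e_i(n̄,-) of A'(T) is the identity or constantly 0
  IdOrZero : (El N → El N) → Set
  IdOrZero E = (∀ x → E x ≡ x) ⊎ (∀ x → E x ≡ ο)

  guarded-IdOrZero : ∀ b → IdOrZero (λ x → if b then join (meet x x) (meet x x) else ο)
  guarded-IdOrZero true = inj₁ (λ x → trans (cong (λ w → join w w) (meet-idem x)) (join-idem x))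
  guarded-IdOrZero false = inj₂ (λ x → refl)

  Fixed : (El N → El N) → El N → El N → Set
  Fixed E R ρ = R ≡ opJ' R ρ (E R)

  fixed-zero : ∀ {E} ρ → Fixed E ο ρ
  fixed-zero {E} ρ = sym (J'-zero ρ (E ο))

  fixed-opposite : ∀ {E} R ρ → opp R ρ ≡ true → Fixed E R ρ
  fixed-opposite {E} R ρ d = sym (J'-opposite R ρ (E R) d)

  fixed-same : ∀ {E R} → E R ≡ R → Fixed E R R
  fixed-same {E} {R} eR = sym (trans (J'-same R (E R)) (trans (cong (meet R) eR) (meet-idem R)))

  fixed-along : ∀ {E} (ρ : El N → El N) {p p′} → p ≡ p′ → Fixed E p′ (ρ p′) → Fixed E p (ρ p)
  fixed-along {E} ρ p≡p′ = subst (λ z → Fixed E z (ρ z)) (sym p≡p′)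

  fixed-at-zero : ∀ {E} (ρ : El N → El N) {p} → p ≡ ο → Fixed E p (ρ p)
  fixed-at-zero {E} ρ p0 = fixed-along {E} ρ p0 (fixed-zero {E} (ρ ο))

  fixed-meet : ∀ {E} (ρ : El N → El N) x y → (x ≡ y → Fixed E x (ρ x)) → Fixed E (meet x y) (ρ (meet x y))
  fixed-meet {E} ρ = meet-elim (λ z → Fixed E z (ρ z)) (fixed-zero {E} (ρ ο))

  diagonal-fixed : ∀ {E} → IdOrZero E → ∀ {p} p₂ q₂ → p ≡ opJ' p₂ q₂ (E p) →
                   Fixed E p (opK p p (opK p₂ q₂ p))
  diagonal-fixed {E} dich {p} p₂ q₂ p≡ with compare p₂ q₂
  ... | opposite d rewrite trans p≡ (J'-opposite p₂ q₂ (E p) d)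
                         | K-opposite p₂ q₂ p₂ d | K-diagonal-opposite p₂ q₂ d =
    fixed-opposite {E} p₂ q₂ d
  ... | apart ne nd =
    fixed-at-zero {E} (λ z → opK z z (opK p₂ q₂ z)) (trans p≡ (J'-apart p₂ q₂ (E p) ne nd))
  ... | same refl with dich
  ...   | inj₂ zero =
    fixed-at-zero {E} (λ z → opK z z (opK p₂ p₂ z))
      (trans p≡ (trans (J'-same p₂ (E p)) (trans (cong (meet p₂) (zero p)) (meet-zeroʳ p₂))))
  ...   | inj₁ ident with meet-flat p₂ p
  ...     | inj₂ refl rewrite K-diagonal p₂ | K-diagonal p₂ = fixed-same {E} (ident p₂)
  ...     | inj₁ e =
    fixed-at-zero {E} (λ z → opK z z (opK p₂ p₂ z))
      (trans p≡ (trans (J'-same p₂ (E p)) (trans (cong (meet p₂) (ident p)) e)))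

  Admissible : (El N → El N) → El N → El N → Set
  Admissible E R ρ = (R ≡ ο) ⊎ (opp R ρ ≡ true) ⊎ ((R ≡ ρ) × (∀ x → E x ≡ x))

  fixJ'-admissible : ∀ {E} → IdOrZero E → ∀ a ρ → Admissible E (opJ' a ρ (E a)) ρ
  fixJ'-admissible {E} dich a ρ with compare a ρ
  ... | opposite d rewrite J'-opposite a ρ (E a) d = inj₂ (inj₁ d)
  ... | apart ne nd = inj₁ (J'-apart a ρ (E a) ne nd)
  ... | same refl with dich
  ...   | inj₁ ident = inj₂ (inj₂ (trans (J'-same a (E a)) (trans (cong (meet a) (ident a)) (meet-idem a)) , ident))
  ...   | inj₂ zero = inj₁ (trans (J'-same a (E a)) (trans (cong (meet a) (zero a)) (meet-zeroʳ a)))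

  meet-J-zero : (x R : El N) → meet x R ≡ opJ (meet x R) R ο
  meet-J-zero x R = meet-elim (λ z → z ≡ opJ z R ο) (sym (J-zero R ο)) x R (λ { refl → sym (J-same x ο) })

  lower-laws : ∀ {E R ρ} → Admissible E R ρ → ∀ s →
    let S = meet s R ; U = opJ' R ρ (E S) in
    (U ≡ opJ U ρ (opS2 R ρ R R R)) × (S ≡ opJ U ρ (opS2 R ρ S S S))
  lower-laws {E} {ρ = ρ} (inj₁ refl) s rewrite J'-zero ρ (E (meet s ο)) =
    sym (J-zero ρ (opS2 ο ρ ο ο ο)) ,
    trans (meet-zeroʳ s) (sym (J-zero ρ (opS2 ο ρ (meet s ο) (meet s ο) (meet s ο))))
  lower-laws {E} {R} {ρ} (inj₂ (inj₁ d)) s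
    rewrite J'-opposite R ρ (E (meet s R)) d | e2-opposite R ρ R d | e2-opposite R ρ (meet s R) d =
    sym (trans (J-opposite R ρ R d) (meet-idem R)) ,
    sym (trans (J-opposite R ρ (meet s R) d) (meet-absorbʳ R s))
  lower-laws {E} {R} (inj₂ (inj₂ (refl , ident))) s
    rewrite e2-diagonal R R | e2-diagonal R (meet s R) | ident (meet s R) | J'-same R (meet s R)
          | meet-absorbʳ R s =
    meet-J-zero s R , meet-J-zero s R

-- A'(T) satisfies the laws.

module _ (T : TM) where
  open Laws (A' T)
  open ≡-Reasoning

  e-IdOrZero : (n̄ : EChoice (A' T)) → IdOrZero (eApp (A' T) n̄)
  e-IdOrZero (ch0 m) = guarded-IdOrZero (inV0 m)
  e-IdOrZero (ch1 m) = guarded-IdOrZero (in12 m)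
  e-IdOrZero (ch2 m m′) = guarded-IdOrZero (opp m m′)

  jj'-absorb-A' : JJ'Absorption
  jj'-absorb-A' p q a b with compare p q
  ... | same refl rewrite J-same p a | J-same p b | J'-same p p | meet-idem p = meet-idem p
  ... | opposite d = begin
    meet (opJ p q a) (opJ' p q (opJ p q b)) ≡⟨ cong₂ meet (J-opposite p q a d) (J'-opposite p q (opJ p q b) d) ⟩
    meet (meet p a) p                       ≡⟨ meet-comm (meet p a) p ⟩
    meet p (meet p a)                       ≡⟨ meet-absorb p a ⟩
    meet p a                                ≡⟨ sym (J-opposite p q a d) ⟩
    opJ p q a                               ∎
  ... | apart ne nd rewrite J-apart p q a ne nd = meet-zeroˡ (opJ' p q (opJ p q b))

  -- By cases on how p₁ and q₁ compare, the sandwich element R is 0, or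
  -- p₁ with p₁ dual to q₁ = pivot, or p₁ = q₁ fixed by J'(p₂,q₂,E(-)).
  pivot-fixes-A' : PivotFixes
  pivot-fixes-A' n̄ a b p₁ q₁ p₂ q₂ = by-comparison q₁ (compare p₁ q₁)
    where
      E : El (N T) → El (N T)
      E = eApp (A' T) n̄

      pivot-of : El (N T) → El (N T) → El (N T)
      pivot-of q R = opK R q (opK p₂ q₂ q)

      by-comparison : ∀ q → Comparison p₁ q →
        let R = sandwich n̄ a b p₁ q p₂ q₂ in Fixed E R (pivot-of q R)
      by-comparison q (apart ne nd) =
        fixed-at-zero {E = E} (pivot-of q) (trans (cong (λ w → meet w Y) (J-apart p₁ q a ne nd)) (meet-zeroˡ Y))
        where Y : El (N T)
              Y = opJ' p₁ q (opJ' p₂ q₂ (E (opJ p₁ q b)))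
      by-comparison q (opposite d) =
        fixed-along {E = E} (pivot-of q) R≡ (fixed-meet {E = E} (pivot-of q) p₁ a (λ _ → p₁-fixed))
        where
          R≡ : sandwich n̄ a b p₁ q p₂ q₂ ≡ meet p₁ a
          R≡ = begin
            meet (opJ p₁ q a) (opJ' p₁ q _) ≡⟨ cong₂ meet (J-opposite p₁ q a d) (J'-opposite p₁ q _ d) ⟩
            meet (meet p₁ a) p₁             ≡⟨ meet-comm (meet p₁ a) p₁ ⟩
            meet p₁ (meet p₁ a)             ≡⟨ meet-absorb p₁ a ⟩
            meet p₁ a                       ∎
          p₁-fixed : Fixed E p₁ (pivot-of q p₁)
          p₁-fixed = subst (Fixed E p₁) (sym (K-opposite p₁ q (opK p₂ q₂ q) d)) (fixed-opposite {E = E} p₁ q d)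
      by-comparison .p₁ (same refl) =
        fixed-along {E = E} (pivot-of p₁) R≡ (fixed-meet {E = E} (pivot-of p₁) p₁ X (diagonal-fixed (e-IdOrZero n̄) p₂ q₂))
        where
          X : El (N T)
          X = opJ' p₂ q₂ (E p₁)
          R≡ : sandwich n̄ a b p₁ p₁ p₂ q₂ ≡ meet p₁ X
          R≡ = begin
            meet (opJ p₁ p₁ a) (opJ' p₁ p₁ (opJ' p₂ q₂ (E (opJ p₁ p₁ b))))
              ≡⟨ cong₂ (λ u w → meet u (opJ' p₁ p₁ (opJ' p₂ q₂ (E w)))) (J-same p₁ a) (J-same p₁ b) ⟩
            meet p₁ (opJ' p₁ p₁ X) ≡⟨ cong (meet p₁) (J'-same p₁ X) ⟩
            meet p₁ (meet p₁ X)    ≡⟨ meet-absorb p₁ X ⟩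
            meet p₁ X              ∎

  lower-fixed-A' : LowerFixed
  lower-fixed-A' n̄ a ρ s = proj₁ (lower-laws (fixJ'-admissible (e-IdOrZero n̄) a ρ) s)

  meet-fixed-A' : MeetFixed
  meet-fixed-A' n̄ a ρ s = proj₂ (lower-laws (fixJ'-admissible (e-IdOrZero n̄) a ρ) s)

  A'-laws : SatisfiesLaws (A' T)
  A'-laws = record
    { ∧-assoc = meet-assoc
    ; jj'-absorb = jj'-absorb-A'
    ; pivot-fixes = pivot-fixes-A'
    ; lower-fixed = lower-fixed-A'
    ; meet-fixed = meet-fixed-A'
    }

-- The lemma in any algebra satisfying the laws.

module _ {k : ℕ} {C : Algebra k} (laws : SatisfiesLaws C) where
  open SatisfiesLaws laws
  open Laws C
  open ≡-Reasoning

  ≤-trans : ∀ {s t r} → Leq C s t → Leq C t r → Leq C s r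
  ≤-trans {s} {t} {r} s≤t t≤r = begin
    ∧B C s r          ≡⟨ cong (λ w → ∧B C w r) (sym s≤t) ⟩
    ∧B C (∧B C s t) r ≡⟨ ∧-assoc s t r ⟩
    ∧B C s (∧B C t r) ≡⟨ cong (∧B C s) t≤r ⟩
    ∧B C s t          ≡⟨ s≤t ⟩
    s                 ∎

  sandwich-collapses : ∀ n̄ {r t p₁ q₁ p₂ q₂} →
    r ≡ JB C p₁ q₁ r → t ≡ JB C p₁ q₁ t → t ≡ J'B C p₂ q₂ (eApp C n̄ t) →
    sandwich n̄ r t p₁ q₁ p₂ q₂ ≡ r
  sandwich-collapses n̄ {r} {t} {p₁} {q₁} {p₂} {q₂} r-J t-J t-J' = begin
    ∧B C (JB C p₁ q₁ r) (J'B C p₁ q₁ (J'B C p₂ q₂ (eApp C n̄ (JB C p₁ q₁ t))))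
      ≡⟨ cong (λ w → ∧B C (JB C p₁ q₁ r) (J'B C p₁ q₁ (J'B C p₂ q₂ (eApp C n̄ w)))) (sym t-J) ⟩
    ∧B C (JB C p₁ q₁ r) (J'B C p₁ q₁ (J'B C p₂ q₂ (eApp C n̄ t)))
      ≡⟨ cong (λ w → ∧B C (JB C p₁ q₁ r) (J'B C p₁ q₁ w)) (trans (sym t-J') t-J) ⟩
    ∧B C (JB C p₁ q₁ r) (J'B C p₁ q₁ (JB C p₁ q₁ t))
      ≡⟨ jj'-absorb p₁ q₁ r t ⟩
    JB C p₁ q₁ r
      ≡⟨ sym r-J ⟩
    r ∎

  below-fixed-point : ∀ n̄ {a ρ} s → a ≡ fixJ' n̄ a ρ →
    let U = lower n̄ a ρ s in
    (U ≡ JB C U ρ (e2 C a ρ a)) × (∧B C s a ≡ JB C U ρ (e2 C a ρ (∧B C s a)))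
  below-fixed-point n̄ {a} {ρ} s a-fixed =
    subst Conclusion (sym a-fixed) (lower-fixed n̄ a ρ s , meet-fixed n̄ a ρ s)
    where
      Conclusion : Carrier C → Set
      Conclusion R = let U = lower n̄ R ρ s in
        (U ≡ JB C U ρ (e2 C R ρ R)) × (∧B C s R ≡ JB C U ρ (e2 C R ρ (∧B C s R)))

  sandwich-lemma : (r t s : Carrier C) → Leq C s t → Leq C t r →
    (p₁ p₂ q₁ q₂ : Carrier C) (n̄ : EChoice C) →
    r ≡ JB C p₁ q₁ r → t ≡ JB C p₁ q₁ t → t ≡ J'B C p₂ q₂ (eApp C n̄ t) →
    let ρ = pivot r q₁ p₂ q₂ ; u = J'B C r ρ (eApp C n̄ s) in
    (r ≡ J'B C r ρ (eApp C n̄ r)) × (u ≡ JB C u ρ (e2 C r ρ r)) × (s ≡ JB C u ρ (e2 C r ρ s))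
  sandwich-lemma r t s s≤t t≤r p₁ p₂ q₁ q₂ n̄ r-J t-J t-J' =
    r-fixed , subst Below (≤-trans s≤t t≤r) (below-fixed-point n̄ s r-fixed)
    where
      ρ : Carrier C
      ρ = pivot r q₁ p₂ q₂
      r-fixed : r ≡ J'B C r ρ (eApp C n̄ r)
      r-fixed = subst (λ R → R ≡ J'B C R (pivot R q₁ p₂ q₂) (eApp C n̄ R))
                      (sandwich-collapses n̄ r-J t-J t-J') (pivot-fixes n̄ r t p₁ q₁ p₂ q₂)
      Below : Carrier C → Set
      Below x = let u = J'B C r ρ (eApp C n̄ x) in
        (u ≡ JB C u ρ (e2 C r ρ r)) × (x ≡ JB C u ρ (e2 C r ρ x))

lemma4p13 : (T : TM) (B : Algebra (k T)) → InHSP (A' T) B →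
    (c d r t s : Carrier B) →
    Leq B s t → Leq B t r →
    Cg B c d r t → Cg B c d t s →
    (p₁ p₂ q₁ q₂ : Carrier B) (n̄ : EChoice B) →
    r ≡ JB B p₁ q₁ r →
    t ≡ JB B p₁ q₁ t →
    t ≡ J'B B p₂ q₂ (eApp B n̄ t) →
    s ≡ J'B B p₂ q₂ (eApp B n̄ s) →
    Σ (Carrier B) (λ ρ → Σ (Carrier B) (λ u →
      (r ≡ J'B B r ρ (eApp B n̄ r)) ×
      (u ≡ J'B B r ρ (eApp B n̄ s)) ×
      (u ≡ JB B u ρ (e2 B r ρ r)) ×
      (s ≡ JB B u ρ (e2 B r ρ s))))
lemma4p13 T B hsp _ _ r t s s≤t t≤r _ _ p₁ p₂ q₁ q₂ n̄ r-J t-J t-J' _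
  with sandwich-lemma (preserve-laws hsp (A'-laws T)) r t s s≤t t≤r p₁ p₂ q₁ q₂ n̄ r-J t-J t-J'
... | r-fixed , u-fixed , s-fixed =
  ρ , J'B B r ρ (eApp B n̄ s) , r-fixed , refl , u-fixed , s-fixed
  where
    ρ : Carrier B
    ρ = Laws.pivot B r q₁ p₂ q₂
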